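{- Let $n>1$ and $m$ be positive integers with $1<m<n$ and $n/m=p$, where $p$ is a prime number. Then $n$ can be expressed as the sum of $m$ primes, and $$Y(m,m\cdot p)=\sum_{j=2}^{m}Y_{p(0)}(j,j\cdot p)+1.$$
   Context: For positive integers $m,n$ with $m\mid n$, let $S_{m|n}$ be the set of $m$-tuples $(p_1,\dots,p_m)$ of prime numbers with $p_1\le p_2\le\dots\le p_m$ and $\sum_{i=1}^m p_i=n$, and let $Y(m,n)$ be the cardinality of $S_{m|n}$. For a prime $p$ and a positive integer $j$, let $Y_{p(0)}(j,j\cdot p)$ be the number of $j$-tuples $(p_1,\dots,p_j)$ of primes with $p_1\le\dots\le p_j$, $\sum_{i=1}^j p_i=jp$, and $p_i\ne p$ for all $i$. -}

module Defs where

open import Data.Nat using (ℕ; zero; suc; _+_; _*_; _≤_)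
open import Data.Nat.Primality using (Prime; prime?)
open import Data.List using (List; []; _∷_; length; filter; concatMap; map)
open import Data.Nat.ListAction using (sum)
open import Data.List.Relation.Unary.All using (All; all?)
open import Data.Nat.Properties using (_≟_)
open import Data.Product using (_×_)
open import Relation.Nullary using (¬_; Dec)
open import Relation.Nullary.Decidable using (_×-dec_; ¬?)
open import Relation.Binary.PropositionalEquality using (_≡_)


between : ℕ → ℕ → List ℕ
between lo hi = filter (λ v → Data.Nat._≤?_ lo v) (upto hi)
  where
  upto : ℕ → List ℕ
  upto zero = zero ∷ []
  upto (suc h) = suc h ∷ upto h

ndLists : ℕ → ℕ → ℕ → List (List ℕ)
ndLists zero lo hi = [] ∷ []
ndLists (suc k) lo hi = concatMap (λ x → map (x ∷_) (ndLists k x hi)) (between lo hi)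

-- tuples (p₁ ≤ … ≤ p_m), all prime, with sum n.  Entries are ≤ n automatically
-- (all entries are natural numbers summing to n), so enumeration within [0..n] is exhaustive.
S : ℕ → ℕ → List (List ℕ)
S m n = filter (λ xs → all? prime? xs ×-dec (sum xs ≟ n)) (ndLists m 0 n)

Y : ℕ → ℕ → ℕ
Y m n = length (S m n)

Yp0 : ℕ → ℕ → ℕ
Yp0 p j = length (filter (λ xs → all? (λ q → ¬? (q ≟ p)) xs) (S j (j * p)))

sumFromTo : ℕ → ℕ → (ℕ → ℕ) → ℕ
sumFromTo a b f = sum (map f (between a b))

{-# OPTIONS --safe #-}
module Submission where

-- A nondecreasing m-tuple of primes with sum m·p is determined by its
-- subtuple of the j entries different from p: that subtuple is a nondecreasing
-- j-tuple of primes avoiding p with sum j·p, and conversely every such j-tuple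
-- (j ≤ m) is recovered by inserting m − j copies of p in sorted position.
-- Hence Y(m, m·p) = Σ_{j=0}^{m} Y_{p(0)}(j, j·p). The term j = 0 is 1 (the
-- constant tuple (p, …, p), which also shows that m·p is a sum of m primes) and
-- the term j = 1 is 0, since a single prime with sum p is p itself.

open import Defs
open import Data.Empty using (⊥-elim)
open import Data.List
  using (List; []; _∷_; _++_; length; map; filter; concatMap; replicate; downFrom)
open import Data.List.Membership.Propositional using (_∈_; find; lose)
open import Data.List.Membership.Propositional.Properties
  using (∈-filter⁻; ∈-filter⁺; ∈-map⁻; ∈-map⁺; ∈-concatMap⁻; ∈-concatMap⁺; ∈-downFrom⁻; ∈-downFrom⁺)
open import Data.List.Membership.Propositional.Properties.WithK using (unique∧set⇒bag)
open import Data.List.Properties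
  using (filter-accept; filter-reject; filter-all; filter-none; length-map; length-replicate;
         length-++; ++-identityʳ; map-cong; map-cong-local; ∷-injectiveˡ; ∷-injectiveʳ)
open import Data.List.Relation.Binary.BagAndSetEquality using (∼bag⇒↭)
open import Data.List.Relation.Binary.Permutation.Propositional.Properties using (↭-length)
open import Data.List.Relation.Unary.All as All using (All; []; _∷_; all?)
import Data.List.Relation.Unary.All.Properties as All
open import Data.List.Relation.Unary.Any using (here; there)
open import Data.List.Relation.Unary.Unique.Propositional using (Unique; []; _∷_)
import Data.List.Relation.Unary.Unique.Propositional.Properties as Unique
open import Data.Nat using (ℕ; zero; suc; _+_; _*_; _∸_; _≤_; _<_; _≤?_; _<?_; z≤n; s≤s; s≤s⁻¹)
open import Data.Nat.ListAction using (sum)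
open import Data.Nat.ListAction.Properties using (sum-++)
open import Data.Nat.Primality using (Prime; prime?)
open import Data.Nat.Properties
open import Algebra.Properties.CommutativeSemigroup +-commutativeSemigroup
  using (interchange; x∙yz≈y∙xz)
open import Data.Product using (Σ; ∃; _×_; _,_; proj₁; proj₂)
open import Function.Bundles using (mk⇔)
open import Relation.Binary.Definitions using (tri<; tri≈; tri>)
open import Relation.Binary.PropositionalEquality
open import Relation.Nullary using (¬_; Dec; yes; no)
open import Relation.Nullary.Decidable using (_×-dec_; ¬?)

between≡filter-downFrom : ∀ lo hi → between lo hi ≡ filter (lo ≤?_) (downFrom (suc hi))
between≡filter-downFrom lo zero = refl
between≡filter-downFrom lo (suc hi) with lo ≤? suc hi
... | yes lo≤ = begin
  between lo (suc hi)                            ≡⟨ filter-accept (lo ≤?_) lo≤ ⟩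
  suc hi ∷ between lo hi                         ≡⟨ cong (suc hi ∷_) (between≡filter-downFrom lo hi) ⟩
  suc hi ∷ filter (lo ≤?_) (downFrom (suc hi))   ≡⟨ filter-accept (lo ≤?_) lo≤ ⟨
  filter (lo ≤?_) (downFrom (suc (suc hi)))      ∎
  where open ≡-Reasoning
... | no lo≰ = begin
  between lo (suc hi)                            ≡⟨ filter-reject (lo ≤?_) lo≰ ⟩
  between lo hi                                  ≡⟨ between≡filter-downFrom lo hi ⟩
  filter (lo ≤?_) (downFrom (suc hi))            ≡⟨ filter-reject (lo ≤?_) lo≰ ⟨
  filter (lo ≤?_) (downFrom (suc (suc hi)))      ∎
  where open ≡-Reasoning

∈-between⁻ : ∀ {lo hi v} → v ∈ between lo hi → lo ≤ v × v ≤ hi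
∈-between⁻ {lo} {hi} v∈ with ∈-filter⁻ (lo ≤?_) (subst (_ ∈_) (between≡filter-downFrom lo hi) v∈)
... | v∈downFrom , lo≤v = lo≤v , s≤s⁻¹ (∈-downFrom⁻ v∈downFrom)

∈-between⁺ : ∀ {lo hi v} → lo ≤ v → v ≤ hi → v ∈ between lo hi
∈-between⁺ {lo} {hi} lo≤v v≤hi = subst (_ ∈_) (sym (between≡filter-downFrom lo hi))
  (∈-filter⁺ (lo ≤?_) (∈-downFrom⁺ (s≤s v≤hi)) lo≤v)

between-unique : ∀ lo hi → Unique (between lo hi)
between-unique lo hi = subst Unique (sym (between≡filter-downFrom lo hi))
  (Unique.filter⁺ (lo ≤?_) (Unique.downFrom⁺ (suc hi)))

sum-between-0≡sumFromTo-2 : ∀ (f : ℕ → ℕ) k →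
  sum (map f (between 0 (suc k))) ≡ sumFromTo 2 (suc k) f + f 1 + f 0
sum-between-0≡sumFromTo-2 f zero = cong (f 1 +_) (+-identityʳ (f 0))
sum-between-0≡sumFromTo-2 f (suc k) = trans (cong (f (2 + k) +_) (sum-between-0≡sumFromTo-2 f k))
  (trans (sym (+-assoc (f (2 + k)) _ (f 0))) (cong (_+ f 0) (sym (+-assoc (f (2 + k)) _ (f 1)))))

sum-map-+ : ∀ {A : Set} (f g : A → ℕ) xs → sum (map (λ x → f x + g x) xs) ≡ sum (map f xs) + sum (map g xs)
sum-map-+ f g [] = refl
sum-map-+ f g (x ∷ xs) = trans (cong (f x + g x +_) (sum-map-+ f g xs)) (interchange (f x) (g x) _ _)

sum-map-0 : ∀ {A : Set} (xs : List A) → sum (map (λ _ → 0) xs) ≡ 0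
sum-map-0 [] = refl
sum-map-0 (_ ∷ xs) = sum-map-0 xs

All-≤-sum : ∀ xs → All (_≤ sum xs) xs
All-≤-sum [] = []
All-≤-sum (x ∷ xs) = m≤m+n x (sum xs) ∷ All.map (λ y≤ → ≤-trans y≤ (m≤n+m (sum xs) x)) (All-≤-sum xs)

module _ {A B : Set} where

  Unique-map-injectiveOn : (f : A → B) {xs : List A} → Unique xs →
    (∀ {x y} → x ∈ xs → y ∈ xs → f x ≡ f y → x ≡ y) → Unique (map f xs)
  Unique-map-injectiveOn f {[]} [] _ = []
  Unique-map-injectiveOn f {x ∷ xs} (x∉xs ∷ xs!) inj =
    All.tabulate (λ fy∈ fx≡ → let y , y∈xs , fy≡ = ∈-map⁻ f fy∈ in
      All.lookup x∉xs y∈xs (inj (here refl) (there y∈xs) (trans fx≡ fy≡)))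
    ∷ Unique-map-injectiveOn f xs! (λ x∈ y∈ → inj (there x∈) (there y∈))

  Unique-concatMap : (f : A → List B) {xs : List A} → Unique xs → (∀ x → Unique (f x)) →
    (∀ {x x′ y} → y ∈ f x → y ∈ f x′ → x ≡ x′) → Unique (concatMap f xs)
  Unique-concatMap f {[]} [] _ _ = []
  Unique-concatMap f {x ∷ xs} (x∉xs ∷ xs!) f! disjoint =
    Unique.++⁺ (f! x) (Unique-concatMap f xs! f! disjoint) λ (y∈fx , y∈rest) →
      let x′ , x′∈xs , y∈fx′ = find (∈-concatMap⁻ f y∈rest) in
      All.lookup x∉xs x′∈xs (disjoint y∈fx y∈fx′)

  length-≡-bijection : {xs : List A} {ys : List B} → Unique xs → Unique ys → (f : A → B) →
    (∀ {x} → x ∈ xs → f x ∈ ys) →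
    (∀ {x x′} → x ∈ xs → x′ ∈ xs → f x ≡ f x′ → x ≡ x′) →
    (∀ {y} → y ∈ ys → ∃ λ x → x ∈ xs × f x ≡ y) → length xs ≡ length ys
  length-≡-bijection {xs} {ys} xs! ys! f into inj onto =
    trans (sym (length-map f xs)) (↭-length (∼bag⇒↭ (unique∧set⇒bag (Unique-map-injectiveOn f xs! inj) ys!
      (mk⇔ (λ fx∈ → let x , x∈ , eq = ∈-map⁻ f fx∈ in subst (_∈ ys) (sym eq) (into x∈))
           (λ y∈ → let x , x∈ , eq = onto y∈ in subst (_∈ map f xs) eq (∈-map⁺ f x∈))))))

δ : ℕ → ℕ → ℕ
δ a j with a ≟ j
... | yes _ = 1
... | no _ = 0

δ-≡ : ∀ {a j} → a ≡ j → δ a j ≡ 1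
δ-≡ {a} {j} a≡j with a ≟ j
... | yes _ = refl
... | no a≢j = ⊥-elim (a≢j a≡j)

δ-≢ : ∀ {a j} → ¬ a ≡ j → δ a j ≡ 0
δ-≢ {a} {j} a≢j with a ≟ j
... | yes a≡j = ⊥-elim (a≢j a≡j)
... | no _ = refl

sum-δ-∉ : ∀ {a js} → All (λ j → ¬ a ≡ j) js → sum (map (δ a) js) ≡ 0
sum-δ-∉ [] = refl
sum-δ-∉ (a≢j ∷ a∉js) = cong₂ _+_ (δ-≢ a≢j) (sum-δ-∉ a∉js)

sum-δ-∈ : ∀ {a js} → Unique js → a ∈ js → sum (map (δ a) js) ≡ 1
sum-δ-∈ (a∉js ∷ _) (here refl) = cong₂ _+_ (δ-≡ refl) (sum-δ-∉ a∉js)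
sum-δ-∈ (j∉js ∷ js!) (there a∈js) =
  cong₂ _+_ (δ-≢ λ { refl → All.lookup j∉js a∈js refl }) (sum-δ-∈ js! a∈js)

module _ {A : Set} (g : A → ℕ) where

  length-filter-∷ : ∀ x xs j →
    length (filter (λ y → g y ≟ j) (x ∷ xs)) ≡ δ (g x) j + length (filter (λ y → g y ≟ j) xs)
  length-filter-∷ x xs j with g x ≟ j
  ... | yes gx≡j = cong length (filter-accept (λ y → g y ≟ j) gx≡j)
  ... | no gx≢j = cong length (filter-reject (λ y → g y ≟ j) gx≢j)

  length≡sum-length-filter : ∀ {js} → Unique js → ∀ xs → All (λ x → g x ∈ js) xs →
    length xs ≡ sum (map (λ j → length (filter (λ x → g x ≟ j) xs)) js)
  length≡sum-length-filter {js} js! [] [] = sym (sum-map-0 js)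
  length≡sum-length-filter {js} js! (x ∷ xs) (gx∈js ∷ gxs∈js) = begin
    1 + length xs
      ≡⟨ cong₂ _+_ (sym (sum-δ-∈ js! gx∈js)) (length≡sum-length-filter js! xs gxs∈js) ⟩
    sum (map (δ (g x)) js) + sum (map (λ j → length (filter (λ y → g y ≟ j) xs)) js)
      ≡⟨ sum-map-+ (δ (g x)) (λ j → length (filter (λ y → g y ≟ j) xs)) js ⟨
    sum (map (λ j → δ (g x) j + length (filter (λ y → g y ≟ j) xs)) js)
      ≡⟨ cong sum (map-cong (λ j → sym (length-filter-∷ x xs j)) js) ⟩
    sum (map (λ j → length (filter (λ y → g y ≟ j) (x ∷ xs))) js) ∎
    where open ≡-Reasoning

data Nondecreasing : ℕ → List ℕ → Set where
  [] : ∀ {lo} → Nondecreasing lo []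
  _∷_ : ∀ {lo x xs} → lo ≤ x → Nondecreasing x xs → Nondecreasing lo (x ∷ xs)

Nondecreasing-weaken : ∀ {lo lo′ xs} → lo′ ≤ lo → Nondecreasing lo xs → Nondecreasing lo′ xs
Nondecreasing-weaken lo′≤lo [] = []
Nondecreasing-weaken lo′≤lo (lo≤x ∷ xs↑) = ≤-trans lo′≤lo lo≤x ∷ xs↑

Nondecreasing⇒lowerBound : ∀ {lo xs} → Nondecreasing lo xs → All (lo ≤_) xs
Nondecreasing⇒lowerBound [] = []
Nondecreasing⇒lowerBound (lo≤x ∷ xs↑) = lo≤x ∷ All.map (≤-trans lo≤x) (Nondecreasing⇒lowerBound xs↑)

Nondecreasing-filter : ∀ {P : ℕ → Set} (P? : ∀ x → Dec (P x)) {lo xs} →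
  Nondecreasing lo xs → Nondecreasing lo (filter P? xs)
Nondecreasing-filter P? [] = []
Nondecreasing-filter P? {xs = x ∷ _} (lo≤x ∷ xs↑) with P? x
... | yes _ = lo≤x ∷ Nondecreasing-filter P? xs↑
... | no _ = Nondecreasing-weaken lo≤x (Nondecreasing-filter P? xs↑)

∈-ndLists⁻ : ∀ k lo hi {xs} → xs ∈ ndLists k lo hi →
  length xs ≡ k × Nondecreasing lo xs × All (_≤ hi) xs
∈-ndLists⁻ zero lo hi (here refl) = refl , [] , []
∈-ndLists⁻ (suc k) lo hi xs∈
  with find (∈-concatMap⁻ (λ x → map (x ∷_) (ndLists k x hi)) {between lo hi} xs∈)
... | x , x∈ , xs∈′ with ∈-map⁻ (x ∷_) xs∈′
... | ys , ys∈ , refl with ∈-ndLists⁻ k x hi ys∈ | ∈-between⁻ x∈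
... | refl , ys↑ , ys≤hi | lo≤x , x≤hi = refl , lo≤x ∷ ys↑ , x≤hi ∷ ys≤hi

∈-ndLists⁺ : ∀ k lo hi {xs} → length xs ≡ k → Nondecreasing lo xs → All (_≤ hi) xs →
  xs ∈ ndLists k lo hi
∈-ndLists⁺ zero lo hi {[]} refl [] [] = here refl
∈-ndLists⁺ (suc k) lo hi {x ∷ xs} refl (lo≤x ∷ xs↑) (x≤hi ∷ xs≤hi) =
  ∈-concatMap⁺ (λ y → map (y ∷_) (ndLists k y hi))
    (lose {P = λ y → x ∷ xs ∈ map (y ∷_) (ndLists k y hi)} (∈-between⁺ lo≤x x≤hi)
      (∈-map⁺ (x ∷_) (∈-ndLists⁺ k x hi refl xs↑ xs≤hi)))

ndLists-unique : ∀ k lo hi → Unique (ndLists k lo hi)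
ndLists-unique zero lo hi = [] ∷ []
ndLists-unique (suc k) lo hi =
  Unique-concatMap (λ x → map (x ∷_) (ndLists k x hi)) (between-unique lo hi)
    (λ x → Unique.map⁺ ∷-injectiveʳ (ndLists-unique k x hi)) same-head
  where
  same-head : ∀ {x x′ ys} → ys ∈ map (x ∷_) (ndLists k x hi) → ys ∈ map (x′ ∷_) (ndLists k x′ hi) → x ≡ x′
  same-head ys∈ ys∈′ with ∈-map⁻ _ ys∈ | ∈-map⁻ _ ys∈′
  ... | _ , _ , refl | _ , _ , eq = ∷-injectiveˡ eq

∈-S⁻ : ∀ m n {xs} → xs ∈ S m n → length xs ≡ m × Nondecreasing 0 xs × All Prime xs × sum xs ≡ n
∈-S⁻ m n xs∈ with ∈-filter⁻ (λ xs → all? prime? xs ×-dec (sum xs ≟ n)) xs∈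
... | xs∈nd , primes , sum≡ with ∈-ndLists⁻ m 0 n xs∈nd
... | length≡ , xs↑ , _ = length≡ , xs↑ , primes , sum≡

∈-S⁺ : ∀ m n {xs} → length xs ≡ m → Nondecreasing 0 xs → All Prime xs → sum xs ≡ n → xs ∈ S m n
∈-S⁺ m n {xs} length≡ xs↑ primes refl =
  ∈-filter⁺ (λ ys → all? prime? ys ×-dec (sum ys ≟ sum xs))
    (∈-ndLists⁺ m 0 (sum xs) length≡ xs↑ (All-≤-sum xs)) (primes , refl)

S-unique : ∀ m n → Unique (S m n)
S-unique m n = Unique.filter⁺ (λ xs → all? prime? xs ×-dec (sum xs ≟ n)) (ndLists-unique m 0 n)

module Copies (p : ℕ) where

  erase : List ℕ → List ℕ
  erase = filter (λ q → ¬? (q ≟ p))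

  multiplicity : List ℕ → ℕ
  multiplicity xs = length (filter (_≟ p) xs)

  insertCopies : ℕ → List ℕ → List ℕ
  insertCopies k [] = replicate k p
  insertCopies k (y ∷ ys) with y <? p
  ... | yes _ = y ∷ insertCopies k ys
  ... | no _ = replicate k p ++ y ∷ ys

  erase-≢ : ∀ {x xs} → ¬ x ≡ p → erase (x ∷ xs) ≡ x ∷ erase xs
  erase-≢ = filter-accept (λ q → ¬? (q ≟ p))

  erase-≡ : ∀ {xs} → erase (p ∷ xs) ≡ erase xs
  erase-≡ = filter-reject (λ q → ¬? (q ≟ p)) (λ p≢p → p≢p refl)

  multiplicity-≢ : ∀ {x xs} → ¬ x ≡ p → multiplicity (x ∷ xs) ≡ multiplicity xs
  multiplicity-≢ x≢p = cong length (filter-reject (_≟ p) x≢p)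

  multiplicity-≡ : ∀ {xs} → multiplicity (p ∷ xs) ≡ suc (multiplicity xs)
  multiplicity-≡ = cong length (filter-accept (_≟ p) refl)

  length-erase : ∀ xs → length xs ≡ length (erase xs) + multiplicity xs
  length-erase [] = refl
  length-erase (x ∷ xs) with x ≟ p
  ... | yes refl rewrite erase-≡ {xs} | multiplicity-≡ {xs} =
    trans (cong suc (length-erase xs)) (sym (+-suc _ _))
  ... | no x≢p rewrite erase-≢ {xs = xs} x≢p | multiplicity-≢ {xs = xs} x≢p =
    cong suc (length-erase xs)

  sum-erase : ∀ xs → sum xs ≡ sum (erase xs) + multiplicity xs * p
  sum-erase [] = refl
  sum-erase (x ∷ xs) with x ≟ p
  ... | yes refl rewrite erase-≡ {xs} | multiplicity-≡ {xs} =
    trans (cong (p +_) (sum-erase xs)) (x∙yz≈y∙xz p (sum (erase xs)) (multiplicity xs * p))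
  ... | no x≢p rewrite erase-≢ {xs = xs} x≢p | multiplicity-≢ {xs = xs} x≢p =
    trans (cong (x +_) (sum-erase xs)) (sym (+-assoc x _ _))

  insertCopies-< : ∀ {k y ys} → y < p → insertCopies k (y ∷ ys) ≡ y ∷ insertCopies k ys
  insertCopies-< {y = y} y<p with y <? p
  ... | yes _ = refl
  ... | no y≮p = ⊥-elim (y≮p y<p)

  insertCopies-≥ : ∀ {k y ys} → ¬ y < p → insertCopies k (y ∷ ys) ≡ replicate k p ++ y ∷ ys
  insertCopies-≥ {y = y} y≮p with y <? p
  ... | yes y<p = ⊥-elim (y≮p y<p)
  ... | no _ = refl

  insertCopies-suc : ∀ {k ys} → All (p ≤_) ys → insertCopies (suc k) ys ≡ p ∷ insertCopies k ys
  insertCopies-suc [] = refl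
  insertCopies-suc (p≤y ∷ _) = trans (insertCopies-≥ (≤⇒≯ p≤y)) (cong (p ∷_) (sym (insertCopies-≥ (≤⇒≯ p≤y))))

  erase-insertCopies : ∀ k ys → All (λ y → ¬ y ≡ p) ys → erase (insertCopies k ys) ≡ ys
  erase-insertCopies zero [] [] = refl
  erase-insertCopies (suc k) [] [] = trans erase-≡ (erase-insertCopies k [] [])
  erase-insertCopies k (y ∷ ys) (y≢p ∷ ys≢p) with y <? p
  ... | yes _ = trans (erase-≢ y≢p) (cong (y ∷_) (erase-insertCopies k ys ys≢p))
  ... | no _ = erase-copies k
    where
    erase-copies : ∀ k → erase (replicate k p ++ y ∷ ys) ≡ y ∷ ys
    erase-copies zero = trans (erase-≢ y≢p) (cong (y ∷_) (filter-all (λ q → ¬? (q ≟ p)) ys≢p))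
    erase-copies (suc k) = trans erase-≡ (erase-copies k)

  above⇒≢ : ∀ {x xs} → p < x → Nondecreasing x xs → All (λ y → ¬ y ≡ p) (x ∷ xs)
  above⇒≢ p<x xs↑ = All.map (λ p<y y≡p → <⇒≢ p<y (sym y≡p)) (p<x ∷ All.map (<-≤-trans p<x) (Nondecreasing⇒lowerBound xs↑))

  insertCopies-erase : ∀ {lo xs} → Nondecreasing lo xs → insertCopies (multiplicity xs) (erase xs) ≡ xs
  insertCopies-erase [] = refl
  insertCopies-erase {xs = x ∷ xs} (_ ∷ xs↑) with <-cmp x p
  ... | tri< x<p x≢p _ rewrite erase-≢ {xs = xs} x≢p | multiplicity-≢ {xs = xs} x≢p =
    trans (insertCopies-< x<p) (cong (x ∷_) (insertCopies-erase xs↑))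
  ... | tri≈ _ refl _ rewrite erase-≡ {xs} | multiplicity-≡ {xs} =
    trans (insertCopies-suc (All.filter⁺ (λ q → ¬? (q ≟ p)) (Nondecreasing⇒lowerBound xs↑)))
          (cong (p ∷_) (insertCopies-erase xs↑))
  ... | tri> _ _ p<x
    rewrite filter-all (λ q → ¬? (q ≟ p)) (above⇒≢ p<x xs↑) | filter-none (_≟ p) (above⇒≢ p<x xs↑) =
    insertCopies-≥ (<⇒≯ p<x)

  erase-injective : ∀ {lo lo′ xs ys} → Nondecreasing lo xs → Nondecreasing lo′ ys →
    length xs ≡ length ys → erase xs ≡ erase ys → xs ≡ ys
  erase-injective {xs = xs} {ys} xs↑ ys↑ length≡ erase≡ = begin
    xs                                                ≡⟨ insertCopies-erase xs↑ ⟨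
    insertCopies (multiplicity xs) (erase xs)         ≡⟨ cong₂ insertCopies multiplicity≡ erase≡ ⟩
    insertCopies (multiplicity ys) (erase ys)         ≡⟨ insertCopies-erase ys↑ ⟩
    ys                                                ∎
    where
    open ≡-Reasoning
    multiplicity≡ : multiplicity xs ≡ multiplicity ys
    multiplicity≡ = +-cancelˡ-≡ (length (erase xs)) _ _
      (trans (sym (length-erase xs)) (trans length≡ (trans (length-erase ys) (cong (λ zs → length zs + _) (sym erase≡)))))

  length-insertCopies : ∀ k ys → length (insertCopies k ys) ≡ length ys + k
  length-insertCopies k [] = length-replicate k
  length-insertCopies k (y ∷ ys) with y <? p
  ... | yes _ = cong suc (length-insertCopies k ys)
  ... | no _ = trans (length-++ (replicate k p)) (trans (cong (_+ _) (length-replicate k)) (+-comm k _))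

  sum-replicate : ∀ k → sum (replicate k p) ≡ k * p
  sum-replicate zero = refl
  sum-replicate (suc k) = cong (p +_) (sum-replicate k)

  sum-insertCopies : ∀ k ys → sum (insertCopies k ys) ≡ sum ys + k * p
  sum-insertCopies k [] = sum-replicate k
  sum-insertCopies k (y ∷ ys) with y <? p
  ... | yes _ = trans (cong (y +_) (sum-insertCopies k ys)) (sym (+-assoc y _ _))
  ... | no _ = trans (sum-++ (replicate k p) (y ∷ ys)) (trans (cong (_+ _) (sum-replicate k)) (+-comm (k * p) _))

  Nondecreasing-replicate-++ : ∀ {lo} k {zs} → lo ≤ p → Nondecreasing p zs → Nondecreasing lo (replicate k p ++ zs)
  Nondecreasing-replicate-++ zero lo≤p zs↑ = Nondecreasing-weaken lo≤p zs↑
  Nondecreasing-replicate-++ (suc k) lo≤p zs↑ = lo≤p ∷ Nondecreasing-replicate-++ k ≤-refl zs↑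

  Nondecreasing-insertCopies : ∀ {lo} k {ys} → lo ≤ p → Nondecreasing lo ys → Nondecreasing lo (insertCopies k ys)
  Nondecreasing-insertCopies k {[]} lo≤p [] =
    subst (Nondecreasing _) (++-identityʳ (replicate k p)) (Nondecreasing-replicate-++ k lo≤p [])
  Nondecreasing-insertCopies k {y ∷ ys} lo≤p (lo≤y ∷ ys↑) with y <? p
  ... | yes y<p = lo≤y ∷ Nondecreasing-insertCopies k (<⇒≤ y<p) ys↑
  ... | no y≮p = Nondecreasing-replicate-++ k lo≤p (≮⇒≥ y≮p ∷ ys↑)

  All-insertCopies : ∀ {P : ℕ → Set} k {ys} → P p → All P ys → All P (insertCopies k ys)
  All-insertCopies k {[]} Pp [] = All.replicate⁺ k Pp
  All-insertCopies k {y ∷ ys} Pp (Py ∷ Pys) with y <? p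
  ... | yes _ = Py ∷ All-insertCopies k Pp Pys
  ... | no _ = All.++⁺ (All.replicate⁺ k Pp) (Py ∷ Pys)

  S-others : ℕ → ℕ → List (List ℕ)
  S-others m j = filter (λ xs → length (erase xs) ≟ j) (S m (m * p))

  S-avoiding : ℕ → List (List ℕ)
  S-avoiding j = filter (λ xs → all? (λ q → ¬? (q ≟ p)) xs) (S j (j * p))

  erase-∈-S-avoiding : ∀ {m j xs} → xs ∈ S-others m j → erase xs ∈ S-avoiding j
  erase-∈-S-avoiding {m} {j} {xs} xs∈ with ∈-filter⁻ (λ xs → length (erase xs) ≟ j) xs∈
  ... | xs∈S , refl with ∈-S⁻ m (m * p) xs∈S
  ... | refl , xs↑ , primes , sum≡ =
    ∈-filter⁺ (λ xs → all? (λ q → ¬? (q ≟ p)) xs)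
      (∈-S⁺ j (j * p) refl (Nondecreasing-filter (λ q → ¬? (q ≟ p)) xs↑)
        (All.filter⁺ (λ q → ¬? (q ≟ p)) primes) sum-erase≡)
      (All.all-filter (λ q → ¬? (q ≟ p)) xs)
    where
    open ≡-Reasoning
    sum-erase≡ : sum (erase xs) ≡ length (erase xs) * p
    sum-erase≡ = +-cancelʳ-≡ (multiplicity xs * p) _ _ (begin
      sum (erase xs) + multiplicity xs * p              ≡⟨ sum-erase xs ⟨
      sum xs                                            ≡⟨ sum≡ ⟩
      length xs * p                                     ≡⟨ cong (_* p) (length-erase xs) ⟩
      (length (erase xs) + multiplicity xs) * p         ≡⟨ *-distribʳ-+ p (length (erase xs)) _ ⟩
      length (erase xs) * p + multiplicity xs * p       ∎)

  insertCopies-∈-S-others : Prime p → ∀ {m j ys} → j ≤ m → ys ∈ S-avoiding j →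
    insertCopies (m ∸ j) ys ∈ S-others m j
  insertCopies-∈-S-others p-prime {m} {j} {ys} j≤m ys∈ with ∈-filter⁻ (λ xs → all? (λ q → ¬? (q ≟ p)) xs) ys∈
  ... | ys∈S , ys≢p with ∈-S⁻ j (j * p) ys∈S
  ... | refl , ys↑ , primes , sum≡ =
    ∈-filter⁺ (λ xs → length (erase xs) ≟ j)
      (∈-S⁺ m (m * p) (trans (length-insertCopies (m ∸ j) ys) j+[m∸j]≡m)
        (Nondecreasing-insertCopies (m ∸ j) z≤n ys↑) (All-insertCopies (m ∸ j) p-prime primes) sum≡m*p)
      (cong length (erase-insertCopies (m ∸ j) ys ys≢p))
    where
    open ≡-Reasoning
    j+[m∸j]≡m : length ys + (m ∸ j) ≡ m
    j+[m∸j]≡m = m+[n∸m]≡n j≤m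
    sum≡m*p : sum (insertCopies (m ∸ j) ys) ≡ m * p
    sum≡m*p = begin
      sum (insertCopies (m ∸ j) ys)    ≡⟨ sum-insertCopies (m ∸ j) ys ⟩
      sum ys + (m ∸ j) * p             ≡⟨ cong (_+ (m ∸ j) * p) sum≡ ⟩
      length ys * p + (m ∸ j) * p      ≡⟨ *-distribʳ-+ p (length ys) (m ∸ j) ⟨
      (length ys + (m ∸ j)) * p        ≡⟨ cong (_* p) j+[m∸j]≡m ⟩
      m * p                            ∎

  length-S-others : Prime p → ∀ {m j} → j ≤ m → length (S-others m j) ≡ Yp0 p j
  length-S-others p-prime {m} {j} j≤m =
    length-≡-bijection
      (Unique.filter⁺ (λ xs → length (erase xs) ≟ j) (S-unique m (m * p)))
      (Unique.filter⁺ (λ xs → all? (λ q → ¬? (q ≟ p)) xs) (S-unique j (j * p)))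
      erase (erase-∈-S-avoiding {m} {j}) injective surjective
    where
    in-S : ∀ {xs} → xs ∈ S-others m j → xs ∈ S m (m * p)
    in-S xs∈ = proj₁ (∈-filter⁻ (λ xs → length (erase xs) ≟ j) xs∈)
    injective : ∀ {xs ys} → xs ∈ S-others m j → ys ∈ S-others m j → erase xs ≡ erase ys → xs ≡ ys
    injective xs∈ ys∈ with ∈-S⁻ m (m * p) (in-S xs∈) | ∈-S⁻ m (m * p) (in-S ys∈)
    ... | length-xs , xs↑ , _ | length-ys , ys↑ , _ = erase-injective xs↑ ys↑ (trans length-xs (sym length-ys))
    surjective : ∀ {ys} → ys ∈ S-avoiding j → ∃ λ xs → xs ∈ S-others m j × erase xs ≡ ys
    surjective {ys} ys∈ with ∈-filter⁻ (λ xs → all? (λ q → ¬? (q ≟ p)) xs) {xs = S j (j * p)} ys∈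
    ... | _ , ys≢p = insertCopies (m ∸ j) ys , insertCopies-∈-S-others p-prime j≤m ys∈ ,
                     erase-insertCopies (m ∸ j) ys ys≢p

  Y≡sum-Yp0 : Prime p → ∀ m → Y m (m * p) ≡ sum (map (Yp0 p) (between 0 m))
  Y≡sum-Yp0 p-prime m = begin
    length (S m (m * p))
      ≡⟨ length≡sum-length-filter (λ xs → length (erase xs)) (between-unique 0 m) (S m (m * p))
           (All.tabulate λ xs∈ → ∈-between⁺ {0} {m} z≤n (erased-length≤m xs∈)) ⟩
    sum (map (λ j → length (S-others m j)) (between 0 m))
      ≡⟨ cong sum (map-cong-local
           (All.tabulate λ j∈ → length-S-others p-prime (proj₂ (∈-between⁻ {0} {m} j∈)))) ⟩
    sum (map (Yp0 p) (between 0 m)) ∎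
    where
    open ≡-Reasoning
    erased-length≤m : ∀ {xs} → xs ∈ S m (m * p) → length (erase xs) ≤ m
    erased-length≤m {xs} xs∈ =
      subst (length (erase xs) ≤_) (trans (sym (length-erase xs)) (proj₁ (∈-S⁻ m (m * p) xs∈))) (m≤m+n _ _)

  Yp0-1 : Yp0 p 1 ≡ 0
  Yp0-1 with S-avoiding 1 in eq
  ... | [] = refl
  ... | ys ∷ _ with ∈-filter⁻ (λ xs → all? (λ q → ¬? (q ≟ p)) xs) (subst (ys ∈_) (sym eq) (here refl))
  ... | ys∈S , ys≢p with ∈-S⁻ 1 (1 * p) ys∈S
  Yp0-1 | (q ∷ []) ∷ _ | _ , (q≢p ∷ []) | _ , _ , _ , sum≡ =
    ⊥-elim (q≢p (trans (sym (+-identityʳ q)) (trans sum≡ (+-identityʳ p))))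

corollary1 : (m n p : ℕ) → Prime p → 1 < m → m < n → n ≡ m * p →
    Σ (List ℕ) (λ xs → length xs ≡ m × All Prime xs × sum xs ≡ n)
    × Y m (m * p) ≡ sumFromTo 2 m (Yp0 p) + 1
corollary1 (suc k) n p p-prime (s≤s _) _ refl =
  (replicate (suc k) p , length-replicate (suc k) , All.replicate⁺ (suc k) p-prime , sum-replicate (suc k)) ,
  (begin
    Y (suc k) (suc k * p)                                    ≡⟨ Y≡sum-Yp0 p-prime (suc k) ⟩
    sum (map (Yp0 p) (between 0 (suc k)))                    ≡⟨ sum-between-0≡sumFromTo-2 (Yp0 p) k ⟩
    -- Yp0 p 0 computes to 1: the empty tuple is the only one.
    sumFromTo 2 (suc k) (Yp0 p) + Yp0 p 1 + 1                ≡⟨ cong (λ t → sumFromTo 2 (suc k) (Yp0 p) + t + 1) Yp0-1 ⟩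
    sumFromTo 2 (suc k) (Yp0 p) + 0 + 1                      ≡⟨ cong (_+ 1) (+-identityʳ _) ⟩
    sumFromTo 2 (suc k) (Yp0 p) + 1                          ∎)
  where
  open ≡-Reasoning
  open Copies p
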